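{- Let $K_{L,R}$ be a complete bipartite graph with partitions $V_L$ ($|V_L|=L$) and $V_R$ ($|V_R|=R$), and run the Balanced (1+1) EA with fitness $f$ on it. Let $L_t=V_L\cap X_t$, $R_t=V_R\cap X_t$, $T_L=\inf\{t: |L_t|=L\}$, $T'_R=\inf\{t:|R_t|\ge R-L\}$, and let $S_t\subseteq V_R$ be the process defined below. Then $R_t\subseteq S_t$ for all $t\le\min\{T_L,T'_R\}$.
   Context: $K_{L,R}$ has vertex set $V=V_L\cup V_R$ and edges all $\{v,u\}$ with $v\in V_L,u\in V_R$; $n=L+R$. Bit strings are identified with vertex sets; $f(X)=|X|_1+(n+1)u(X)$, $|X|_1$ the number of ones and $u(X)$ the number of uncovered edges. Balanced (1+1) EA: in each iteration, with probability $1/2$ a standard mutation: choose the set $A\subseteq V$ containing each vertex independently with probability $1/n$ and let $Y$ be $X$ with the bits of $A$ flipped; otherwise a balanced flip: pick $v\in V$ uniformly at random, let $N_v$ be the neighbours $u$ of $v$ with $x_u\ne x_v$; if $N_v=\emptyset$ the iteration ends with $X$ unchanged, otherwise pick $u\in N_v$ uniformly and let $Y$ be $X$ with bits of $u,v$ flipped; then set $X\gets Y$ if $f(Y)\le f(X)$. $X_t$ is the state after $t$ iterations. The process $S_t$: $S_0=R_0$; if iteration $t+1$ is a standard mutation with chosen set $A$ (whether or not $Y$ is accepted), $S_{t+1}=S_t\cup(V_R\cap A)$; if it is a balanced flip with initial vertex $v$, then $S_{t+1}=S_t\setminus\{v\}$. -}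

module Defs where

open import Data.Nat using (ℕ; zero; suc; _+_; _*_; _∸_; _<_; _≤ᵇ_)
open import Data.Bool using (Bool; true; false; if_then_else_; not; _∧_; _∨_; _xor_)
open import Data.Fin using (Fin; zero; suc; _≟_)
open import Data.Sum using (_⊎_; inj₁; inj₂)
open import Data.Empty using (⊥)
open import Data.Unit using (⊤)
open import Relation.Nullary using (¬_)
open import Relation.Nullary.Decidable using (⌊_⌋)
open import Relation.Binary.PropositionalEquality using (_≡_)

count : ∀ {m} → (Fin m → Bool) → ℕ
count {zero}  b = 0
count {suc m} b = (if b zero then 1 else 0) + count (λ i → b (suc i))

sumF : ∀ {m} → (Fin m → ℕ) → ℕ
sumF {zero}  g = 0
sumF {suc m} g = g zero + sumF (λ i → g (suc i))

module _ (L R : ℕ) where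

  -- vertex set V = V_L ∪ V_R (disjoint union)
  V : Set
  V = Fin L ⊎ Fin R

  Adj : V → V → Set
  Adj (inj₁ _) (inj₂ _) = ⊤
  Adj (inj₂ _) (inj₁ _) = ⊤
  Adj (inj₁ _) (inj₁ _) = ⊥
  Adj (inj₂ _) (inj₂ _) = ⊥

  -- bit strings (= vertex sets)
  BitString : Set
  BitString = V → Bool

  SubR : Set
  SubR = Fin R → Bool

  eqV : V → V → Bool
  eqV (inj₁ i) (inj₁ j) = ⌊ i ≟ j ⌋
  eqV (inj₂ i) (inj₂ j) = ⌊ i ≟ j ⌋
  eqV (inj₁ _) (inj₂ _) = false
  eqV (inj₂ _) (inj₁ _) = false

  ones : BitString → ℕ
  ones X = count (λ i → X (inj₁ i)) + count (λ j → X (inj₂ j))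

  uncovered : BitString → ℕ
  uncovered X = sumF (λ i → sumF (λ j →
    if not (X (inj₁ i)) ∧ not (X (inj₂ j)) then 1 else 0))

  fitness : BitString → ℕ
  fitness X = ones X + suc (L + R) * uncovered X

  flipSet : BitString → (V → Bool) → BitString
  flipSet X A w = X w xor A w

  flip2 : BitString → V → V → BitString
  flip2 X u v w = if eqV w u ∨ eqV w v then not (X w) else X w

  accept : BitString → BitString → BitString
  accept X Y = if fitness Y ≤ᵇ fitness X then Y else X

  removeV : V → SubR → SubR
  removeV (inj₁ _) S j = S j
  removeV (inj₂ i) S j = S j ∧ not ⌊ i ≟ j ⌋

  -- One iteration of the Balanced (1+1) EA jointly with the process S,
  -- for every possible outcome of the random choices.
  -- Trans X S X' S' : (X,S) can move to (X',S') in one iteration.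
  data Trans (X : BitString) (S : SubR) (X' : BitString) (S' : SubR) : Set where
    standard : (A : V → Bool) →
               (∀ w → X' w ≡ accept X (flipSet X A) w) →
               (∀ j → S' j ≡ (S j ∨ A (inj₂ j))) →
               Trans X S X' S'
    -- balanced flip with initial vertex v and N_v = ∅
    balancedEmpty : (v : V) →
               (∀ u → Adj v u → X u ≡ X v) →
               (∀ w → X' w ≡ X w) →
               (∀ j → S' j ≡ removeV v S j) →
               Trans X S X' S'
    -- balanced flip with initial vertex v and chosen u ∈ N_v
    balancedFlip : (v u : V) → Adj v u → ¬ (X u ≡ X v) →
               (∀ w → X' w ≡ accept X (flip2 X u v) w) →
               (∀ j → S' j ≡ removeV v S j) →
               Trans X S X' S'

  record Run : Set where
    field
      X : ℕ → BitString
      S : ℕ → SubR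
      init : ∀ j → S 0 j ≡ X 0 (inj₂ j)
      step : ∀ t → Trans (X t) (S t) (X (suc t)) (S (suc t))

  sizeL : BitString → ℕ
  sizeL X = count (λ i → X (inj₁ i))

  sizeR : BitString → ℕ
  sizeR X = count (λ j → X (inj₂ j))

-- Only a balanced flip can remove a vertex from S_t, and it removes its initial vertex v.
-- While L_t ≠ V_L, an empty neighbourhood of v ∈ V_R forces x_v = 0.  A balanced flip
-- of u ∈ V_L and v ∈ V_R with x_u ≠ x_v keeps |X|_1 and changes u(X) from a·b to
-- (a ± 1)(b ∓ 1), where a and b count the zeros in V_L and V_R.  While |R_t| < R - L we
-- have a < L ≤ b - 1, so moving a one from V_L to V_R strictly increases f and is
-- rejected, whereas moving it back strictly decreases f and is accepted.  Either way the
-- right vertex of the pair is 0 afterwards and R_t shrinks, so R_t ⊆ S_t is preserved.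
module Submission where

open import Defs
open import Data.Nat using (ℕ; _<_; _∸_)
open import Data.Bool using (true)
open import Data.Fin using (Fin)
open import Data.Sum using (inj₂)
open import Data.Product using (_×_)
open import Relation.Nullary using (¬_)
open import Relation.Binary.PropositionalEquality using (_≡_)

open import Data.Nat using (zero; suc; _+_; _*_; _≤_; _≤ᵇ_; s≤s)
open import Data.Nat.Properties
open import Data.Bool using (Bool; false; not; _∧_; _∨_; _xor_; if_then_else_; T)
open import Data.Bool.Properties using (∨-comm; ∨-zeroʳ; not-involutive)
open import Data.Fin using (zero; suc) renaming (_≟_ to _≟ᶠ_)
import Data.Fin.Properties as Fin
open import Data.Sum using (inj₁; _⊎_)
open import Data.Sum.Properties using (inj₂-injective)
open import Data.Product using (_,_; proj₁; proj₂)
open import Data.Unit using (tt)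
open import Function using (_∘_)
open import Relation.Nullary using (Dec; contradiction)
open import Relation.Nullary.Decidable using (⌊_⌋; isYes≗does; dec-true; dec-false)
open import Relation.Binary.PropositionalEquality
  using (_≢_; refl; sym; trans; cong; cong₂; subst; subst₂; module ≡-Reasoning)

private
  variable
    m : ℕ

⌊⌋-true : ∀ {A : Set} (a? : Dec A) → A → ⌊ a? ⌋ ≡ true
⌊⌋-true a? a = trans (isYes≗does a?) (dec-true a? a)

⌊⌋-false : ∀ {A : Set} (a? : Dec A) → ¬ A → ⌊ a? ⌋ ≡ false
⌊⌋-false a? ¬a = trans (isYes≗does a?) (dec-false a? ¬a)

xor≡true : ∀ {x y} → x xor y ≡ true → x ≡ true ⊎ y ≡ true
xor≡true {true}  _ = inj₁ refl
xor≡true {false} e = inj₂ e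

≢-not : ∀ {x y} → x ≢ y → x ≡ not y
≢-not {false} {false} x≢y = contradiction refl x≢y
≢-not {false} {true}  _   = refl
≢-not {true}  {false} _   = refl
≢-not {true}  {true}  x≢y = contradiction refl x≢y

m<[1+m+n]∸o⇒o≤n : ∀ m n o → m < suc (m + n) ∸ o → o ≤ n
m<[1+m+n]∸o⇒o≤n m n o m<∸ = +-cancelˡ-≤ (suc m) o n
  (m≤o∸n⇒m+n≤o (suc m) (<⇒≤ (m∸n≢0⇒n<m ∸≢0)) m<∸)
  where
  ∸≢0 : suc (m + n) ∸ o ≢ 0
  ∸≢0 e = n≮0 (subst (m <_) e m<∸)

*-suc-<-suc-* : ∀ {a b} → a < b → a * suc b < suc a * b
*-suc-<-suc-* {a} {b} a<b = subst (_< suc a * b) (sym (*-suc a b)) (+-monoˡ-< (a * b) a<b)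

count-cong : {b b′ : Fin m → Bool} → (∀ i → b i ≡ b′ i) → count b ≡ count b′
count-cong {zero}  eq = refl
count-cong {suc m} eq =
  cong₂ _+_ (cong (λ x → if x then 1 else 0) (eq zero)) (count-cong (λ i → eq (suc i)))

count-all-true : (b : Fin m → Bool) → (∀ i → b i ≡ true) → count b ≡ m
count-all-true {zero}  b all = refl
count-all-true {suc m} b all rewrite all zero = cong suc (count-all-true _ (λ i → all (suc i)))

count+count-not : (b : Fin m → Bool) → count b + count (λ i → not (b i)) ≡ m
count+count-not {zero}  b = refl
count+count-not {suc m} b with b zero
... | true  = cong suc (count+count-not (λ i → b (suc i)))
... | false = trans (+-suc _ _) (cong suc (count+count-not (λ i → b (suc i))))

count-clear : (b b′ : Fin m → Bool) (k : Fin m) → b k ≡ true → b′ k ≡ false →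
  (∀ k′ → k′ ≢ k → b′ k′ ≡ b k′) → count b ≡ suc (count b′)
count-clear b b′ zero bk b′k same rewrite bk | b′k =
  cong suc (count-cong (λ i → sym (same (suc i) (λ ()))))
count-clear b b′ (suc k) bk b′k same rewrite same zero (λ ()) =
  trans (cong ((if b zero then 1 else 0) +_)
           (count-clear _ _ k bk b′k (λ k′ k′≢k → same (suc k′) (k′≢k ∘ Fin.suc-injective))))
        (+-suc _ _)

sumF-zero : sumF {m} (λ _ → 0) ≡ 0
sumF-zero {zero}  = refl
sumF-zero {suc m} = sumF-zero {m}

sumF-if : (p : Fin m → Bool) (c : ℕ) → sumF (λ i → if p i then c else 0) ≡ count p * c
sumF-if {zero}  p c = refl
sumF-if {suc m} p c with p zero
... | true  = cong (c +_) (sumF-if (λ i → p (suc i)) c)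
... | false = sumF-if (λ i → p (suc i)) c

sumF-cong : {g g′ : Fin m → ℕ} → (∀ i → g i ≡ g′ i) → sumF g ≡ sumF g′
sumF-cong {zero}  eq = refl
sumF-cong {suc m} eq = cong₂ _+_ (eq zero) (sumF-cong (λ i → eq (suc i)))

sumF-sumF-∧ : ∀ {l r} (p : Fin l → Bool) (q : Fin r → Bool) →
  sumF (λ i → sumF (λ j → if p i ∧ q j then 1 else 0)) ≡ count p * count q
sumF-sumF-∧ {r = r} p q = trans (sumF-cong row) (sumF-if p (count q))
  where
  row : ∀ i → sumF (λ j → if p i ∧ q j then 1 else 0) ≡ (if p i then count q else 0)
  row i with p i
  ... | true  = trans (sumF-if q 1) (*-identityʳ (count q))
  ... | false = sumF-zero {r}

module _ {L R : ℕ} where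

  zerosL zerosR : BitString L R → ℕ
  zerosL X = count (λ i → not (X (inj₁ i)))
  zerosR X = count (λ j → not (X (inj₂ j)))

  uncovered≡zerosL*zerosR : ∀ X → uncovered L R X ≡ zerosL X * zerosR X
  uncovered≡zerosL*zerosR X = sumF-sumF-∧ (λ i → not (X (inj₁ i))) (λ j → not (X (inj₂ j)))

  record IsSwap (X Y : BitString L R) (i : Fin L) (k : Fin R) : Set where
    field
      flipsˡ : Y (inj₁ i) ≡ not (X (inj₁ i))
      flipsʳ : Y (inj₂ k) ≡ not (X (inj₂ k))
      keepsˡ : ∀ i′ → i′ ≢ i → Y (inj₁ i′) ≡ X (inj₁ i′)
      keepsʳ : ∀ k′ → k′ ≢ k → Y (inj₂ k′) ≡ X (inj₂ k′)

  IsSwap-sym : ∀ {X Y i k} → IsSwap X Y i k → IsSwap Y X i k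
  IsSwap-sym {X} {Y} {i} {k} s = record
    { flipsˡ = flipped flipsˡ
    ; flipsʳ = flipped flipsʳ
    ; keepsˡ = λ i′ i′≢i → sym (keepsˡ i′ i′≢i)
    ; keepsʳ = λ k′ k′≢k → sym (keepsʳ k′ k′≢k)
    }
    where
    open IsSwap s
    flipped : ∀ {x y} → y ≡ not x → x ≡ not y
    flipped refl = sym (not-involutive _)

  IsSwap-cong : ∀ {X Y Y′ i k} → (∀ w → Y w ≡ Y′ w) → IsSwap X Y i k → IsSwap X Y′ i k
  IsSwap-cong Y≗Y′ s = record
    { flipsˡ = trans (sym (Y≗Y′ _)) flipsˡ
    ; flipsʳ = trans (sym (Y≗Y′ _)) flipsʳ
    ; keepsˡ = λ i′ i′≢i → trans (sym (Y≗Y′ _)) (keepsˡ i′ i′≢i)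
    ; keepsʳ = λ k′ k′≢k → trans (sym (Y≗Y′ _)) (keepsʳ k′ k′≢k)
    }
    where open IsSwap s

  fitness-<-on-equal-ones : ∀ {X Y} → ones L R X ≡ ones L R Y →
    uncovered L R X < uncovered L R Y → fitness L R X < fitness L R Y
  fitness-<-on-equal-ones {X} {Y} ones≡ unc< =
    subst (λ o → fitness L R X < o + suc (L + R) * uncovered L R Y) ones≡
      (+-monoʳ-< (ones L R X) (*-monoʳ-< (suc (L + R)) unc<))

  shiftRight-raises-fitness : ∀ {X Y i k} → IsSwap X Y i k →
    X (inj₁ i) ≡ true → X (inj₂ k) ≡ false → sizeR L R X < R ∸ L →
    fitness L R X < fitness L R Y
  shiftRight-raises-fitness {X} {Y} {i} {k} s xi xk small =
    fitness-<-on-equal-ones {X} {Y} ones≡ (subst₂ _<_ (sym (uncovered≡zerosL*zerosR X))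
                                               (sym (uncovered≡zerosL*zerosR Y)) zeros<)
    where
    open IsSwap s
    yi : Y (inj₁ i) ≡ false
    yi = trans flipsˡ (cong not xi)
    yk : Y (inj₂ k) ≡ true
    yk = trans flipsʳ (cong not xk)

    sizeL≡ : sizeL L R X ≡ suc (sizeL L R Y)
    sizeL≡ = count-clear _ _ i xi yi keepsˡ
    sizeR≡ : sizeR L R Y ≡ suc (sizeR L R X)
    sizeR≡ = count-clear _ _ k yk xk (λ k′ k′≢k → sym (keepsʳ k′ k′≢k))
    zerosL≡ : zerosL Y ≡ suc (zerosL X)
    zerosL≡ = count-clear _ _ i (cong not yi) (cong not xi)
                (λ i′ i′≢i → cong not (sym (keepsˡ i′ i′≢i)))
    zerosR≡ : zerosR X ≡ suc (zerosR Y)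
    zerosR≡ = count-clear _ _ k (cong not xk) (cong not yk) (λ k′ k′≢k → cong not (keepsʳ k′ k′≢k))

    ones≡ : ones L R X ≡ ones L R Y
    ones≡ = begin
      sizeL L R X + sizeR L R X        ≡⟨ cong (_+ sizeR L R X) sizeL≡ ⟩
      suc (sizeL L R Y) + sizeR L R X  ≡⟨ sym (+-suc (sizeL L R Y) (sizeR L R X)) ⟩
      sizeL L R Y + suc (sizeR L R X)  ≡⟨ cong (sizeL L R Y +_) (sym sizeR≡) ⟩
      sizeL L R Y + sizeR L R Y        ∎
      where open ≡-Reasoning

    zerosLX<L : zerosL X < L
    zerosLX<L = subst (zerosL X <_) (count+count-not (λ i → X (inj₁ i)))
      (subst (λ n → zerosL X < n + zerosL X) (sym sizeL≡) (s≤s (m≤n+m _ _)))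
    L≤zerosRY : L ≤ zerosR Y
    L≤zerosRY = m<[1+m+n]∸o⇒o≤n (sizeR L R X) (zerosR Y) L
      (subst (λ n → sizeR L R X < n ∸ L) R≡ small)
      where
      R≡ : R ≡ suc (sizeR L R X + zerosR Y)
      R≡ = begin
        R                                 ≡⟨ sym (count+count-not (λ j → X (inj₂ j))) ⟩
        sizeR L R X + zerosR X            ≡⟨ cong (sizeR L R X +_) zerosR≡ ⟩
        sizeR L R X + suc (zerosR Y)      ≡⟨ +-suc (sizeR L R X) (zerosR Y) ⟩
        suc (sizeR L R X + zerosR Y)      ∎
        where open ≡-Reasoning

    zeros< : zerosL X * zerosR X < zerosL Y * zerosR Y
    zeros< = subst₂ (λ a b → zerosL X * a < b * zerosR Y) (sym zerosR≡) (sym zerosL≡)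
      (*-suc-<-suc-* (<-≤-trans zerosLX<L L≤zerosRY))

  accept-either : ∀ X Y w → accept L R X Y w ≡ X w ⊎ accept L R X Y w ≡ Y w
  accept-either X Y w with fitness L R Y ≤ᵇ fitness L R X
  ... | true  = inj₂ refl
  ... | false = inj₁ refl

  accept-rejects : ∀ X Y → fitness L R X < fitness L R Y → ∀ w → accept L R X Y w ≡ X w
  accept-rejects X Y X<Y w with fitness L R Y ≤ᵇ fitness L R X in eq
  ... | true  = contradiction (≤ᵇ⇒≤ _ _ (subst T (sym eq) tt)) (<⇒≱ X<Y)
  ... | false = refl

  accept-takes : ∀ X Y → fitness L R Y ≤ fitness L R X → ∀ w → accept L R X Y w ≡ Y w
  accept-takes X Y Y≤X w with fitness L R Y ≤ᵇ fitness L R X in eq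
  ... | true  = refl
  ... | false = contradiction (subst T eq (≤⇒≤ᵇ Y≤X)) (λ ())

  eqV-refl : ∀ w → eqV L R w w ≡ true
  eqV-refl (inj₁ i) = ⌊⌋-true (i ≟ᶠ i) refl
  eqV-refl (inj₂ j) = ⌊⌋-true (j ≟ᶠ j) refl

  flip2-hit : ∀ X u v w → (eqV L R w u ∨ eqV L R w v) ≡ true → flip2 L R X u v w ≡ not (X w)
  flip2-hit X u v w hit = cong (if_then not (X w) else X w) hit

  flip2-miss : ∀ X u v w → (eqV L R w u ∨ eqV L R w v) ≡ false → flip2 L R X u v w ≡ X w
  flip2-miss X u v w miss = cong (if_then not (X w) else X w) miss

  flip2-comm : ∀ X u v w → flip2 L R X u v w ≡ flip2 L R X v u w
  flip2-comm X u v w = cong (if_then not (X w) else X w) (∨-comm (eqV L R w u) (eqV L R w v))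

  flip2-isSwap : ∀ X i k → IsSwap X (flip2 L R X (inj₁ i) (inj₂ k)) i k
  flip2-isSwap X i k = record
    { flipsˡ = flip2-hit X (inj₁ i) (inj₂ k) (inj₁ i) (cong (_∨ false) (eqV-refl (inj₁ i)))
    ; flipsʳ = flip2-hit X (inj₁ i) (inj₂ k) (inj₂ k) (eqV-refl (inj₂ k))
    ; keepsˡ = λ i′ i′≢i →
        flip2-miss X (inj₁ i) (inj₂ k) (inj₁ i′) (cong (_∨ false) (⌊⌋-false (i′ ≟ᶠ i) i′≢i))
    ; keepsʳ = λ k′ k′≢k → flip2-miss X (inj₁ i) (inj₂ k) (inj₂ k′) (⌊⌋-false (k′ ≟ᶠ k) k′≢k)
    }

  -- A swap of unequal bits is accepted iff it moves the one from V_R to V_L, so the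
  -- right vertex ends up 0 in both cases.
  accept-swap-clears-right : ∀ {X Y i k} → IsSwap X Y i k → X (inj₁ i) ≢ X (inj₂ k) →
    sizeR L R X < R ∸ L → accept L R X Y (inj₂ k) ≡ false
  accept-swap-clears-right {X} {Y} {i} {k} s xi≢xk small with X (inj₂ k) in xk
  ... | false = trans (accept-rejects X Y (shiftRight-raises-fitness s xi xk small) _) xk
    where
    xi : X (inj₁ i) ≡ true
    xi = ≢-not xi≢xk
  ... | true  = trans (accept-takes X Y (<⇒≤ Y<X) _) (trans flipsʳ (cong not xk))
    where
    open IsSwap s
    xi : X (inj₁ i) ≡ false
    xi = ≢-not xi≢xk
    yi : Y (inj₁ i) ≡ true
    yi = trans flipsˡ (cong not xi)
    yk : Y (inj₂ k) ≡ false
    yk = trans flipsʳ (cong not xk)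
    sizeR≡ : sizeR L R X ≡ suc (sizeR L R Y)
    sizeR≡ = count-clear _ _ k xk yk keepsʳ
    Y<X : fitness L R Y < fitness L R X
    Y<X = shiftRight-raises-fitness (IsSwap-sym s) yi yk
            (<-trans (subst (sizeR L R Y <_) (sym sizeR≡) (n<1+n _)) small)

  accept-swap-right⊆ : ∀ {X Y i k} → IsSwap X Y i k → X (inj₁ i) ≢ X (inj₂ k) →
    sizeR L R X < R ∸ L → ∀ j → accept L R X Y (inj₂ j) ≡ true →
    X (inj₂ j) ≡ true × j ≢ k
  accept-swap-right⊆ {X} {Y} {i} {k} s xi≢xk small j x′j = xj , j≢k
    where
    j≢k : j ≢ k
    j≢k refl with () ← trans (sym x′j) (accept-swap-clears-right s xi≢xk small)
    xj : X (inj₂ j) ≡ true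
    xj with accept-either X Y (inj₂ j)
    ... | inj₁ e = trans (sym e) x′j
    ... | inj₂ e = trans (sym (IsSwap.keepsʳ s j j≢k)) (trans (sym e) x′j)

  accept-flipSet-true : ∀ X A w → accept L R X (flipSet L R X A) w ≡ true →
    X w ≡ true ⊎ A w ≡ true
  accept-flipSet-true X A w x′w with accept-either X (flipSet L R X A) w
  ... | inj₁ e = inj₁ (trans (sym e) x′w)
  ... | inj₂ e = xor≡true (trans (sym e) x′w)

  _⊆ᴿ_ : BitString L R → SubR L R → Set
  X ⊆ᴿ S = ∀ j → X (inj₂ j) ≡ true → S j ≡ true

  removeV-keeps : ∀ {S : SubR L R} {j} v → S j ≡ true → v ≢ inj₂ j → removeV L R v S j ≡ true
  removeV-keeps (inj₁ i) Sj _   = Sj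
  removeV-keeps {S} {j} (inj₂ k) Sj v≢j =
    cong₂ (λ a b → a ∧ not b) Sj (⌊⌋-false (k ≟ᶠ j) (v≢j ∘ cong inj₂))

  balanced-preserves-⊆ᴿ : ∀ {X S X′ S′} v →
    (∀ j → X′ (inj₂ j) ≡ true → X (inj₂ j) ≡ true × v ≢ inj₂ j) →
    (∀ j → S′ j ≡ removeV L R v S j) → X ⊆ᴿ S → X′ ⊆ᴿ S′
  balanced-preserves-⊆ᴿ v shrinks S′≡ X⊆S j x′j =
    trans (S′≡ j) (removeV-keeps v (X⊆S j (proj₁ (shrinks j x′j))) (proj₂ (shrinks j x′j)))

  isolated-right-vertex-is-zero : ∀ {X j} v → (∀ u → Adj L R v u → X u ≡ X v) →
    sizeL L R X ≢ L → X (inj₂ j) ≡ true → v ≢ inj₂ j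
  isolated-right-vertex-is-zero (inj₁ i) _ _ _ ()
  isolated-right-vertex-is-zero {X} (inj₂ k) same notFull xj refl =
    notFull (count-all-true _ (λ i → trans (same (inj₁ i) tt) xj))

  step-preserves-⊆ᴿ : ∀ {X S X′ S′} → sizeL L R X ≢ L → sizeR L R X < R ∸ L →
    Trans L R X S X′ S′ → X ⊆ᴿ S → X′ ⊆ᴿ S′
  step-preserves-⊆ᴿ {X} {S} _ _ (standard A X′≡ S′≡) X⊆S j x′j
    with accept-flipSet-true X A (inj₂ j) (trans (sym (X′≡ _)) x′j)
  ... | inj₁ xj = trans (S′≡ j) (cong (_∨ A (inj₂ j)) (X⊆S j xj))
  ... | inj₂ aj = trans (S′≡ j) (trans (cong (S j ∨_) aj) (∨-zeroʳ (S j)))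
  step-preserves-⊆ᴿ {X} {S} {X′} {S′} notFull _ (balancedEmpty v same X′≡ S′≡) =
    balanced-preserves-⊆ᴿ {X} {S} {X′} {S′} v shrinks S′≡
    where
    shrinks : ∀ j → X′ (inj₂ j) ≡ true → X (inj₂ j) ≡ true × v ≢ inj₂ j
    shrinks j x′j = xj , isolated-right-vertex-is-zero v same notFull xj
      where
      xj : X (inj₂ j) ≡ true
      xj = trans (sym (X′≡ _)) x′j
  step-preserves-⊆ᴿ {X} {S} {X′} {S′} _ small (balancedFlip (inj₁ i) (inj₂ k) _ xk≢xi X′≡ S′≡) =
    balanced-preserves-⊆ᴿ {X} {S} {X′} {S′} (inj₁ i) shrinks S′≡
    where
    s : IsSwap X (flip2 L R X (inj₂ k) (inj₁ i)) i k
    s = IsSwap-cong (flip2-comm X (inj₁ i) (inj₂ k)) (flip2-isSwap X i k)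
    shrinks : ∀ j → X′ (inj₂ j) ≡ true → X (inj₂ j) ≡ true × inj₁ i ≢ inj₂ j
    shrinks j x′j =
      proj₁ (accept-swap-right⊆ s (xk≢xi ∘ sym) small j (trans (sym (X′≡ _)) x′j)) , λ ()
  step-preserves-⊆ᴿ {X} {S} {X′} {S′} _ small (balancedFlip (inj₂ k) (inj₁ i) _ xi≢xk X′≡ S′≡) =
    balanced-preserves-⊆ᴿ {X} {S} {X′} {S′} (inj₂ k) shrinks S′≡
    where
    shrinks : ∀ j → X′ (inj₂ j) ≡ true → X (inj₂ j) ≡ true × inj₂ k ≢ inj₂ j
    shrinks j x′j
      with accept-swap-right⊆ (flip2-isSwap X i k) xi≢xk small j (trans (sym (X′≡ _)) x′j)
    ... | xj , j≢k = xj , j≢k ∘ sym ∘ inj₂-injective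

mainTheorem15 : (L R : ℕ) (run : Run L R) (t : ℕ) →
    (∀ s → s < t →
    ¬ (sizeL L R (Run.X run s) ≡ L) × sizeR L R (Run.X run s) < R ∸ L) →
    ∀ (j : Fin R) → Run.X run t (inj₂ j) ≡ true → Run.S run t j ≡ true
mainTheorem15 L R run zero    _      j xj = trans (Run.init run j) xj
mainTheorem15 L R run (suc t) before =
  step-preserves-⊆ᴿ notFull small (Run.step run t)
    (mainTheorem15 L R run t (λ s s<t → before s (<-trans s<t (n<1+n t))))
  where
  notFull : sizeL L R (Run.X run t) ≢ L
  notFull = proj₁ (before t (n<1+n t))
  small : sizeR L R (Run.X run t) < R ∸ L
  small = proj₂ (before t (n<1+n t))
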